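{- Let $G=\bigoplus_{q\in\mathcal{Q}}\mathbb{Z}_q$ be a finite Abelian group and let $n$, $d$, $s$ be positive integers. If for some $q\in\mathcal{Q}$ there is an unsatisfiable instance $\mathbb{A}$ of $3\mathrm{LIN}(\mathbb{Z}_q)$ with $n$ variables such that every Frege refutation of $\mathrm{CNF}(\mathbb{A},\mathbb{B}(\mathbb{Z}_q,3))$ of depth $d$ has size at least $s$, then there is an unsatisfiable instance $\mathbb{A}'$ of $3\mathrm{LIN}(G)$ with $n$ variables such that every Frege refutation of $\mathrm{CNF}(\mathbb{A}',\mathbb{B}(G,3))$ of depth $d$ has size at least $s$.
   Context: For a finite Abelian group $G$, $\mathbb{B}(G,3)$ is the structure with domain $G$ having one ternary relation symbol for each distinct relation of the form $\{(g_1,g_2,g_3)\in G^3:z_1g_1+z_2g_2+z_3g_3=g\}$ ($g\in G$, $z_i\in\mathbb{Z}$), interpreted as that relation. $3\mathrm{LIN}(G)=\mathrm{CSP}(\mathbb{B}(G,3))$: an instance is a finite structure in this vocabulary, i.e. a system of linear equations over $G$ with three variable positions per equation, its variables being the domain elements; it is unsatisfiable if it has no homomorphism to $\mathbb{B}(G,3)$. $\mathrm{CNF}(\mathbb{A},\mathbb{B})$ consists of the clauses $\bigvee_{b\in B}X(a,b)$ ($a\in A$), $\overline{X(a,b_0)}\vee\overline{X(a,b_1)}$ ($a\in A$, $b_0\ne b_1$), and $\bigvee_{i=1}^r\overline{X(a_i,b_i)}$ for each relation symbol $R$ of arity $r$, $(a_1,\dots,a_r)\in R(\mathbb{A})$,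 $(b_1,\dots,b_r)\in B^r\setminus R(\mathbb{B})$. Frege (Tait-style, negation normal form) rules: axiom $A\vee\overline A$, cut, introduction of conjunction $C\vee A,D\vee B\vdash C\vee D\vee(A\wedge B)$, weakening; size = total formula size; $\Sigma_{1,1}$ = clauses, $\Pi_{1,1}$ = terms, $\Sigma_{t,1}$ = disjunctions of $\Pi_{t-1,1}$-formulas, $\Pi_{t,1}$ = conjunctions of $\Sigma_{t-1,1}$-formulas; a Frege refutation of depth $d$ uses only $\Sigma_{d,1}$-formulas. -}

module Defs where

open import Data.Nat using (ℕ; zero; suc; _+_)
open import Data.Integer as ℤ using (ℤ; +_)
open import Data.Integer.Divisibility using (_∣_)
open import Data.Fin using (Fin; toℕ)
open import Data.Bool using (Bool; true; false; not)
open import Data.Unit using (⊤; tt)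
open import Data.Empty using (⊥)
open import Data.Product using (_×_; _,_; ∃; ∃-syntax; Σ)
open import Data.List using (List; []; _∷_; _++_; map; concatMap; allFin)
open import Data.Nat.ListAction using (sum)
open import Data.List.Relation.Unary.All using (All)
open import Data.List.Membership.Propositional using (_∈_)
open import Data.List.Relation.Binary.Subset.Propositional using (_⊆_)
open import Relation.Nullary using (¬_)
open import Relation.Binary.PropositionalEquality using (_≡_; _≢_)

-- Finite Abelian groups  G = ⊕_{q ∈ qs} ℤ_q   (qs a list of moduli)

Elem : List ℕ → Set
Elem []       = ⊤
Elem (q ∷ qs) = Fin q × Elem qs

elems : (qs : List ℕ) → List (Elem qs)
elems []       = tt ∷ []
elems (q ∷ qs) = concatMap (λ x → map (λ r → (x , r)) (elems qs)) (allFin q)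

-- z1·g1 + z2·g2 + z3·g3 = g  in G  (componentwise; in ℤ_q this is
-- congruence modulo q of the integer representatives)
Holds : (qs : List ℕ) → ℤ → ℤ → ℤ → Elem qs → Elem qs → Elem qs → Elem qs → Set
Holds []       z₁ z₂ z₃ _ _ _ _ = ⊤
Holds (q ∷ qs) z₁ z₂ z₃ (x₁ , r₁) (x₂ , r₂) (x₃ , r₃) (g , r) =
  ((+ q) ∣ ((z₁ ℤ.* + toℕ x₁ ℤ.+ z₂ ℤ.* + toℕ x₂ ℤ.+ z₃ ℤ.* + toℕ x₃) ℤ.- + toℕ g))
  × Holds qs z₁ z₂ z₃ r₁ r₂ r₃ r

-- Instances of 3LIN(G) with n variables (domain Fin n).
-- A relation symbol of 𝔹(G,3) is named by parameters (z₁,z₂,z₃,g); an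
-- instance is a finite list of tuples (symbol, (a₁,a₂,a₃)) ∈ R(𝔸).

record Eqn (qs : List ℕ) (n : ℕ) : Set where
  constructor eqn
  field
    z₁ z₂ z₃ : ℤ
    rhs      : Elem qs
    a₁ a₂ a₃ : Fin n

Instance : List ℕ → ℕ → Set
Instance qs n = List (Eqn qs n)

IsHom : ∀ {qs n} → Instance qs n → (Fin n → Elem qs) → Set
IsHom {qs} A h = All (λ e → let open Eqn e in
                   Holds qs z₁ z₂ z₃ (h a₁) (h a₂) (h a₃) rhs) A

Unsatisfiable : ∀ {qs n} → Instance qs n → Set
Unsatisfiable {qs} {n} A = ¬ (Σ (Fin n → Elem qs) (IsHom A))

data Form (V : Set) : Set where
  lit  : V → Bool → Form V          -- lit v true = v, lit v false = ¬v
  _∧ᶠ_ : Form V → Form V → Form V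
  _∨ᶠ_ : Form V → Form V → Form V

module _ {V : Set} where

  dual : Form V → Form V
  dual (lit v b) = lit v (not b)
  dual (A ∧ᶠ B)  = dual A ∨ᶠ dual B
  dual (A ∨ᶠ B)  = dual A ∧ᶠ dual B

  fsize : Form V → ℕ
  fsize (lit _ _) = 1
  fsize (A ∧ᶠ B)  = suc (fsize A + fsize B)
  fsize (A ∨ᶠ B)  = suc (fsize A + fsize B)

  flat : Form V → List (Form V)
  flat (A ∨ᶠ B) = flat A ++ flat B
  flat A        = A ∷ []

  -- Σ_{t,1} / Π_{t,1}  (Σ_{0,1} = Π_{0,1} = literals)
  data IsΣ : ℕ → Form V → Set
  data IsΠ : ℕ → Form V → Set
  data IsΣ where
    litΣ : ∀ {t v b} → IsΣ t (lit v b)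
    orΣ  : ∀ {t A B} → IsΣ (suc t) A → IsΣ (suc t) B → IsΣ (suc t) (A ∨ᶠ B)
    Π⇒Σ  : ∀ {t A} → IsΠ t A → IsΣ (suc t) A
  data IsΠ where
    litΠ : ∀ {t v b} → IsΠ t (lit v b)
    andΠ : ∀ {t A B} → IsΠ (suc t) A → IsΠ (suc t) B → IsΠ (suc t) (A ∧ᶠ B)
    Σ⇒Π  : ∀ {t A} → IsΣ t A → IsΠ (suc t) A

  -- A line is a disjunction, given as a list of formulas (a cedent);
  -- lines are identified up to the set of their (flattened) disjuncts.
  Line : Set
  Line = List (Form V)

  ⟦_⟧ : Line → List (Form V)
  ⟦ Γ ⟧ = concatMap flat Γ

  _≋_ : List (Form V) → List (Form V) → Set
  X ≋ Y = (X ⊆ Y) × (Y ⊆ X)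

  lineSize : Line → ℕ
  lineSize Γ = sum (map fsize Γ)

  -- One inference of Tait-style Frege, from hypotheses Hyp, with
  -- previously derived lines `prev`.
  data Rule (Hyp : List (Form V) → Set) (prev : List Line) : Line → Set where
    hyp  : ∀ {Θ K} → Hyp K → ⟦ Θ ⟧ ≋ K → Rule Hyp prev Θ
    axm  : ∀ {Θ} (A : Form V) → ⟦ Θ ⟧ ≋ (flat A ++ flat (dual A)) → Rule Hyp prev Θ
    cut  : ∀ {Θ Γ Δ} (C D : Line) (A : Form V) → Γ ∈ prev → Δ ∈ prev →
           ⟦ Γ ⟧ ≋ (⟦ C ⟧ ++ flat A) → ⟦ Δ ⟧ ≋ (⟦ D ⟧ ++ flat (dual A)) →
           ⟦ Θ ⟧ ≋ (⟦ C ⟧ ++ ⟦ D ⟧) → Rule Hyp prev Θ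
    ∧I   : ∀ {Θ Γ Δ} (C D : Line) (A B : Form V) → Γ ∈ prev → Δ ∈ prev →
           ⟦ Γ ⟧ ≋ (⟦ C ⟧ ++ flat A) → ⟦ Δ ⟧ ≋ (⟦ D ⟧ ++ flat B) →
           ⟦ Θ ⟧ ≋ (⟦ C ⟧ ++ ⟦ D ⟧ ++ flat (A ∧ᶠ B)) → Rule Hyp prev Θ
    weak : ∀ {Θ Γ} → Γ ∈ prev → ⟦ Γ ⟧ ⊆ ⟦ Θ ⟧ → Rule Hyp prev Θ

  -- A derivation: list of lines, most recent first.
  data Derivation (Hyp : List (Form V) → Set) : List Line → Set where
    []   : Derivation Hyp []
    step : ∀ {ls Θ} → Derivation Hyp ls → Rule Hyp ls Θ → Derivation Hyp (Θ ∷ ls)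

  Refutation : (Hyp : List (Form V) → Set) → ℕ → List Line → Set
  Refutation Hyp d ls =
    Σ (List Line) (λ ls′ → (ls ≡ [] ∷ ls′)) × Derivation Hyp ls × All (All (IsΣ d)) ls

  proofSize : List Line → ℕ
  proofSize ls = sum (map lineSize ls)

Var : List ℕ → ℕ → Set
Var qs n = Fin n × Elem qs

X⁺ X⁻ : ∀ {qs n} → Fin n → Elem qs → Form (Var qs n)
X⁺ a b = lit (a , b) true
X⁻ a b = lit (a , b) false

data CNF {qs : List ℕ} {n : ℕ} (A : Instance qs n) : List (Form (Var qs n)) → Set where
  atLeastOne : (a : Fin n) → CNF A (map (X⁺ a) (elems qs))
  atMostOne  : (a : Fin n) (b₀ b₁ : Elem qs) → b₀ ≢ b₁ → CNF A (X⁻ a b₀ ∷ X⁻ a b₁ ∷ [])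
  relation   : (e : Eqn qs n) → e ∈ A → (b₁ b₂ b₃ : Elem qs) →
               ¬ Holds qs (Eqn.z₁ e) (Eqn.z₂ e) (Eqn.z₃ e) b₁ b₂ b₃ (Eqn.rhs e) →
               CNF A (X⁻ (Eqn.a₁ e) b₁ ∷ X⁻ (Eqn.a₂ e) b₂ ∷ X⁻ (Eqn.a₃ e) b₃ ∷ [])

HardAtDepth : ∀ {qs n} → Instance qs n → ℕ → ℕ → Set
HardAtDepth {qs} {n} A d s =
  (ls : List (List (Form (Var qs n)))) → Refutation (CNF A) d ls → s Data.Nat.≤ proofSize ls

-- The instance A over ℤ_q is copied into G by the
-- embedding c ↦ (0,…,0,c,0,…,0); it stays unsatisfiable because a solution
-- over G projects to a solution over ℤ_q.  For the lower bound, restrict a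
-- Frege refutation of CNF(A′, 𝔹(G,3)) by setting X(a,b) to false whenever b
-- lies outside the embedded copy of ℤ_q and renaming X(a, emb c) to X(a,c).
-- Every clause of CNF(A′, 𝔹(G,3)) then either becomes true or becomes a clause
-- of CNF(A, 𝔹(ℤ_q,3)), and a restriction maps every Frege rule to an instance
-- of a Frege rule (or to a weakening of one of its premises), never increases
-- the size of a formula and never increases its depth.  The restricted
-- refutation therefore refutes CNF(A, 𝔹(ℤ_q,3)) at depth d, and is no larger.
module Submission where

open import Defs
open import Data.Nat using (ℕ; zero; suc; _+_; _≤_; _<_; z≤n; s≤s)
open import Data.Nat.Properties using (≤-refl; ≤-trans; +-mono-≤; m≤n+m; m≤m+n; m≤n⇒m≤1+n; ≤-reflexive; +-identityʳ)
open import Data.Nat.Divisibility using (_∣0)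
open import Data.Nat.ListAction.Properties using (sum-++)
open import Data.Integer as ℤ using (ℤ; +_)
open import Data.Integer.Properties using (*-zeroʳ)
open import Data.Integer.Divisibility using (_∣_)
open import Data.Fin using (Fin; zero; suc)
open import Data.Bool using (Bool; true; false; if_then_else_)
open import Data.Maybe as Maybe using (Maybe; just; nothing)
open import Data.Unit using (tt)
open import Data.Empty using (⊥-elim)
open import Data.Product using (Σ; _×_; _,_; proj₁; proj₂)
open import Data.Sum using (inj₁; inj₂; [_,_])
open import Data.List using (List; []; _∷_; _++_; map; concatMap)
open import Data.List.Properties using (map-++; ++-identityʳ; concatMap-++)
open import Data.List.Relation.Unary.All as All using (All; []; _∷_)
open import Data.List.Relation.Unary.All.Properties using (map⁻)
open import Data.List.Relation.Unary.Any using (Any; here; there; any?)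
import Data.List.Relation.Unary.Any.Properties as Anyₚ
open import Data.List.Membership.Propositional using (_∈_; find; lose)
open import Data.List.Membership.Propositional.Properties using (∈-map⁺; ∈-map⁻; ∈-allFin; ∈-concatMap⁺; ∈-concatMap⁻; ∈-++⁻)
open import Data.List.Relation.Binary.Subset.Propositional using (_⊆_)
open import Data.List.Relation.Binary.Subset.Propositional.Properties using (⊆-refl; ⊆-trans; ⊆-reflexive; Any-resp-⊆; concatMap⁺; xs⊆xs++ys; xs⊆ys++xs; ++⁺)
open import Relation.Nullary using (¬_; Dec; yes; no)
open import Function using (_∘_)
open import Relation.Binary.PropositionalEquality using (_≡_; _≢_; refl; sym; cong; cong₂; subst)

++-lub : {A : Set} {P Q T : List A} → P ⊆ T → Q ⊆ T → (P ++ Q) ⊆ T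
++-lub {P = P} P⊆T Q⊆T w∈ = [ P⊆T , Q⊆T ] (∈-++⁻ P w∈)

module _ {V : Set} where

  ≋-reflexive : {X Y : List (Form V)} → X ≡ Y → X ≋ Y
  ≋-reflexive refl = ⊆-refl , ⊆-refl

  ≋-trans : {X Y Z : List (Form V)} → X ≋ Y → Y ≋ Z → X ≋ Z
  ≋-trans (X⊆Y , Y⊆X) (Y⊆Z , Z⊆Y) = ⊆-trans X⊆Y Y⊆Z , ⊆-trans Z⊆Y Y⊆X

  ≋-++⁺ : {X Y X′ Y′ : List (Form V)} → X ≋ X′ → Y ≋ Y′ → (X ++ Y) ≋ (X′ ++ Y′)
  ≋-++⁺ (X⊆ , ⊆X) (Y⊆ , ⊆Y) = ++⁺ X⊆ Y⊆ , ++⁺ ⊆X ⊆Y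

  IsΣ-suc : ∀ {t} {A : Form V} → IsΣ t A → IsΣ (suc t) A
  IsΠ-suc : ∀ {t} {A : Form V} → IsΠ t A → IsΠ (suc t) A
  IsΣ-suc litΣ       = litΣ
  IsΣ-suc (orΣ p q)  = orΣ (IsΣ-suc p) (IsΣ-suc q)
  IsΣ-suc (Π⇒Σ p)    = Π⇒Σ (IsΠ-suc p)
  IsΠ-suc litΠ       = litΠ
  IsΠ-suc (andΠ p q) = andΠ (IsΠ-suc p) (IsΠ-suc q)
  IsΠ-suc (Σ⇒Π p)    = Σ⇒Π (IsΣ-suc p)

  IsΣ-flat : ∀ {t} {A B : Form V} → IsΣ t B → A ∈ flat B → IsΣ t A
  IsΣ-flat {B = lit _ _} p (here refl) = p
  IsΣ-flat {B = _ ∧ᶠ _}  p (here refl) = p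
  IsΣ-flat {B = B₁ ∨ᶠ B₂} (orΣ p q) A∈ with ∈-++⁻ (flat B₁) A∈
  ... | inj₁ A∈₁ = IsΣ-flat p A∈₁
  ... | inj₂ A∈₂ = IsΣ-flat q A∈₂
  IsΣ-flat {B = B₁ ∨ᶠ B₂} (Π⇒Σ (Σ⇒Π p)) A∈ = IsΣ-suc (IsΣ-suc (IsΣ-flat p A∈))

  ∈-flat⇒flat-singleton : {A B : Form V} → A ∈ flat B → flat A ≡ A ∷ []
  ∈-flat⇒flat-singleton {B = lit _ _} (here refl) = refl
  ∈-flat⇒flat-singleton {B = _ ∧ᶠ _}  (here refl) = refl
  ∈-flat⇒flat-singleton {B = B₁ ∨ᶠ B₂} A∈ with ∈-++⁻ (flat B₁) A∈
  ... | inj₁ A∈₁ = ∈-flat⇒flat-singleton {B = B₁} A∈₁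
  ... | inj₂ A∈₂ = ∈-flat⇒flat-singleton {B = B₂} A∈₂

  ⟦⟧-of-flat : (X : List (Form V)) → All (λ A → flat A ≡ A ∷ []) X → ⟦ X ⟧ ≡ X
  ⟦⟧-of-flat []      []         = refl
  ⟦⟧-of-flat (A ∷ X) (fA ∷ fX) = cong₂ _++_ fA (⟦⟧-of-flat X fX)

  lineSize-flat : (A : Form V) → lineSize (flat A) ≤ fsize A
  lineSize-flat (lit _ _) = ≤-refl
  lineSize-flat (A ∧ᶠ B)  = ≤-reflexive (+-identityʳ _)
  lineSize-flat (A ∨ᶠ B)
    rewrite map-++ fsize (flat A) (flat B) | sum-++ (map fsize (flat A)) (map fsize (flat B)) =
    m≤n⇒m≤1+n (+-mono-≤ (lineSize-flat A) (lineSize-flat B))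

  lineSize-concatMap : {U : Set} (f : Form V → List (Form U)) → (∀ A → lineSize (f A) ≤ fsize A) →
                       (X : List (Form V)) → lineSize (concatMap f X) ≤ lineSize X
  lineSize-concatMap f f-size [] = ≤-refl
  lineSize-concatMap f f-size (A ∷ X)
    rewrite map-++ fsize (f A) (concatMap f X) | sum-++ (map fsize (f A)) (map fsize (concatMap f X)) =
    +-mono-≤ (f-size A) (lineSize-concatMap f f-size X)

-- Restriction by a partial renaming of variables

data Restricted (W : Set) : Set where
  top bot : Restricted W
  form    : Form W → Restricted W

module Restriction {V W : Set} (ρ : V → Maybe W) where

  -- variables outside the domain of ρ are set to false
  restrictLit : Maybe W → Bool → Restricted W
  restrictLit (just w) b     = form (lit w b)
  restrictLit nothing  true  = bot
  restrictLit nothing  false = top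

  _∧ʳ_ : Restricted W → Restricted W → Restricted W
  bot    ∧ʳ y      = bot
  top    ∧ʳ y      = y
  form a ∧ʳ bot    = bot
  form a ∧ʳ top    = form a
  form a ∧ʳ form b = form (a ∧ᶠ b)

  _∨ʳ_ : Restricted W → Restricted W → Restricted W
  top    ∨ʳ y      = top
  bot    ∨ʳ y      = y
  form a ∨ʳ top    = top
  form a ∨ʳ bot    = form a
  form a ∨ʳ form b = form (a ∨ᶠ b)

  restrict : Form V → Restricted W
  restrict (lit v b) = restrictLit (ρ v) b
  restrict (A ∧ᶠ B)  = restrict A ∧ʳ restrict B
  restrict (A ∨ᶠ B)  = restrict A ∨ʳ restrict B

  dualʳ : Restricted W → Restricted W
  dualʳ top      = bot
  dualʳ bot      = top
  dualʳ (form a) = form (dual a)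

  restrict-dual : (A : Form V) → restrict (dual A) ≡ dualʳ (restrict A)
  restrict-dual (lit v b) with ρ v
  ... | just w = refl
  restrict-dual (lit v true)  | nothing = refl
  restrict-dual (lit v false) | nothing = refl
  restrict-dual (A ∧ᶠ B) rewrite restrict-dual A | restrict-dual B with restrict A | restrict B
  ... | top    | top    = refl
  ... | top    | bot    = refl
  ... | top    | form _ = refl
  ... | bot    | _      = refl
  ... | form _ | top    = refl
  ... | form _ | bot    = refl
  ... | form _ | form _ = refl
  restrict-dual (A ∨ᶠ B) rewrite restrict-dual A | restrict-dual B with restrict A | restrict B
  ... | top    | _      = refl
  ... | bot    | top    = refl
  ... | bot    | bot    = refl
  ... | bot    | form _ = refl
  ... | form _ | top    = refl
  ... | form _ | bot    = refl
  ... | form _ | form _ = refl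

  sizeʳ : Restricted W → ℕ
  sizeʳ top      = 0
  sizeʳ bot      = 0
  sizeʳ (form a) = fsize a

  sizeʳ-∧ʳ : (x y : Restricted W) → sizeʳ (x ∧ʳ y) ≤ suc (sizeʳ x + sizeʳ y)
  sizeʳ-∧ʳ bot      y        = z≤n
  sizeʳ-∧ʳ top      y        = m≤n⇒m≤1+n ≤-refl
  sizeʳ-∧ʳ (form a) bot      = z≤n
  sizeʳ-∧ʳ (form a) top      = m≤n⇒m≤1+n (m≤m+n _ _)
  sizeʳ-∧ʳ (form a) (form b) = ≤-refl

  sizeʳ-∨ʳ : (x y : Restricted W) → sizeʳ (x ∨ʳ y) ≤ suc (sizeʳ x + sizeʳ y)
  sizeʳ-∨ʳ top      y        = z≤n
  sizeʳ-∨ʳ bot      y        = m≤n⇒m≤1+n ≤-refl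
  sizeʳ-∨ʳ (form a) top      = z≤n
  sizeʳ-∨ʳ (form a) bot      = m≤n⇒m≤1+n (m≤m+n _ _)
  sizeʳ-∨ʳ (form a) (form b) = ≤-refl

  restrict-size : (A : Form V) → sizeʳ (restrict A) ≤ fsize A
  restrict-size (lit v b) with ρ v
  ... | just w = ≤-refl
  restrict-size (lit v true)  | nothing = z≤n
  restrict-size (lit v false) | nothing = z≤n
  restrict-size (A ∧ᶠ B) =
    ≤-trans (sizeʳ-∧ʳ (restrict A) (restrict B)) (s≤s (+-mono-≤ (restrict-size A) (restrict-size B)))
  restrict-size (A ∨ᶠ B) =
    ≤-trans (sizeʳ-∨ʳ (restrict A) (restrict B)) (s≤s (+-mono-≤ (restrict-size A) (restrict-size B)))

  restrict-IsΣ : ∀ {t} {A : Form V} {a : Form W} → IsΣ t A → restrict A ≡ form a → IsΣ t a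
  restrict-IsΠ : ∀ {t} {A : Form V} {a : Form W} → IsΠ t A → restrict A ≡ form a → IsΠ t a
  restrict-IsΣ {A = lit v b} litΣ e with ρ v
  restrict-IsΣ {A = lit v b}     litΣ refl | just w = litΣ
  restrict-IsΣ {A = lit v true}  litΣ ()   | nothing
  restrict-IsΣ {A = lit v false} litΣ ()   | nothing
  restrict-IsΣ {A = A ∨ᶠ B} (orΣ p q) e with restrict A in eA | restrict B in eB
  restrict-IsΣ (orΣ p q) refl | bot    | form b = restrict-IsΣ q eB
  restrict-IsΣ (orΣ p q) refl | form a | bot    = restrict-IsΣ p eA
  restrict-IsΣ (orΣ p q) refl | form a | form b = orΣ (restrict-IsΣ p eA) (restrict-IsΣ q eB)
  restrict-IsΣ (Π⇒Σ p) e = Π⇒Σ (restrict-IsΠ p e)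
  restrict-IsΠ {A = lit v b} litΠ e with ρ v
  restrict-IsΠ {A = lit v b}     litΠ refl | just w = litΠ
  restrict-IsΠ {A = lit v true}  litΠ ()   | nothing
  restrict-IsΠ {A = lit v false} litΠ ()   | nothing
  restrict-IsΠ {A = A ∧ᶠ B} (andΠ p q) e with restrict A in eA | restrict B in eB
  restrict-IsΠ (andΠ p q) refl | top    | form b = restrict-IsΠ q eB
  restrict-IsΠ (andΠ p q) refl | form a | top    = restrict-IsΠ p eA
  restrict-IsΠ (andΠ p q) refl | form a | form b = andΠ (restrict-IsΠ p eA) (restrict-IsΠ q eB)
  restrict-IsΠ (Σ⇒Π p) e = Σ⇒Π (restrict-IsΣ p e)

  disjunctsʳ : Restricted W → List (Form W)
  disjunctsʳ top      = []
  disjunctsʳ bot      = []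
  disjunctsʳ (form a) = flat a

  residueOf : Form V → List (Form W)
  residueOf A = disjunctsʳ (restrict A)

  -- disjuncts restricted to top vanish too, so this is the restricted line only if the line is not Satisfied
  residue : List (Form V) → List (Form W)
  residue = concatMap residueOf

  residue-++ : (X Y : List (Form V)) → residue (X ++ Y) ≡ residue X ++ residue Y
  residue-++ = concatMap-++ residueOf

  residue-≋ : {X Y : List (Form V)} → X ≋ Y → residue X ≋ residue Y
  residue-≋ (X⊆Y , Y⊆X) = concatMap⁺ residueOf X⊆Y , concatMap⁺ residueOf Y⊆X

  residueOf-flat : {A : Form V} {w : Form W} → w ∈ residueOf A → flat w ≡ w ∷ []
  residueOf-flat {A} w∈ with restrict A
  ... | form a = ∈-flat⇒flat-singleton {B = a} w∈

  ⟦residue⟧ : (X : List (Form V)) → ⟦ residue X ⟧ ≡ residue X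
  ⟦residue⟧ X = ⟦⟧-of-flat (residue X) (All.tabulate λ w∈ →
    let (A , _ , w∈A) = find (∈-concatMap⁻ residueOf {xs = X} w∈) in residueOf-flat {A} w∈A)

  residueOf-IsΣ : ∀ {t} {A : Form V} {w : Form W} → IsΣ t A → w ∈ residueOf A → IsΣ t w
  residueOf-IsΣ {A = A} p w∈ with restrict A in e
  ... | form a = IsΣ-flat (restrict-IsΣ p e) w∈

  residueOf-size : (A : Form V) → lineSize (residueOf A) ≤ fsize A
  residueOf-size A = ≤-trans (disjuncts-size (restrict A)) (restrict-size A)
    where
    disjuncts-size : (r : Restricted W) → lineSize (disjunctsʳ r) ≤ sizeʳ r
    disjuncts-size top      = z≤n
    disjuncts-size bot      = z≤n
    disjuncts-size (form a) = lineSize-flat a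

  Satisfied : List (Form V) → Set
  Satisfied = Any (λ A → restrict A ≡ top)

  satisfied? : (X : List (Form V)) → Dec (Satisfied X)
  satisfied? = any? λ A → top? (restrict A)
    where
    top? : (r : Restricted W) → Dec (r ≡ top)
    top? top      = yes refl
    top? bot      = no λ ()
    top? (form _) = no λ ()

  ¬Satisfied-⊆ : {X Y : List (Form V)} → X ⊆ Y → ¬ Satisfied Y → ¬ Satisfied X
  ¬Satisfied-⊆ X⊆Y ¬Y sat = ¬Y (Any-resp-⊆ X⊆Y sat)

  ¬Satisfied-++ : (X : List (Form V)) {Y : List (Form V)} → ¬ Satisfied X → ¬ Satisfied Y → ¬ Satisfied (X ++ Y)
  ¬Satisfied-++ X ¬X ¬Y sat = [ ¬X , ¬Y ] (Anyₚ.++⁻ X sat)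

  Residual : List (Form V) → List (Form W) → Set
  Residual X P = ¬ Satisfied X × residue X ≋ P

  Residual-++ : ∀ {X Y P Q} → Residual X P → Residual Y Q → Residual (X ++ Y) (P ++ Q)
  Residual-++ {X} {Y} (¬X , X≋P) (¬Y , Y≋Q) =
    ¬Satisfied-++ X ¬X ¬Y , ≋-trans (≋-reflexive (residue-++ X Y)) (≋-++⁺ X≋P Y≋Q)

  Residual-respˡ : ∀ {X Y P} → X ≋ Y → Residual Y P → Residual X P
  Residual-respˡ X≋Y (¬Y , Y≋P) = ¬Satisfied-⊆ (proj₁ X≋Y) ¬Y , ≋-trans (residue-≋ X≋Y) Y≋P

  _restrictsTo_ : List (Form V) → Restricted W → Set
  X restrictsTo top    = Satisfied X
  X restrictsTo bot    = Residual X []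
  X restrictsTo form a = Residual X (flat a)

  restrictsTo-∨ʳ : ∀ {X Y} x y → X restrictsTo x → Y restrictsTo y → (X ++ Y) restrictsTo (x ∨ʳ y)
  restrictsTo-∨ʳ         top      _        X⊨ _  = Anyₚ.++⁺ˡ X⊨
  restrictsTo-∨ʳ {X}     bot      top      _  Y⊨ = Anyₚ.++⁺ʳ X Y⊨
  restrictsTo-∨ʳ         bot      bot      X⊨ Y⊨ = Residual-++ X⊨ Y⊨
  restrictsTo-∨ʳ         bot      (form b) X⊨ Y⊨ = Residual-++ X⊨ Y⊨
  restrictsTo-∨ʳ {X}     (form a) top      _  Y⊨ = Anyₚ.++⁺ʳ X Y⊨
  restrictsTo-∨ʳ {X} {Y} (form a) bot      X⊨ Y⊨ =
    subst (Residual (X ++ Y)) (++-identityʳ (flat a)) (Residual-++ X⊨ Y⊨)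
  restrictsTo-∨ʳ         (form a) (form b) X⊨ Y⊨ = Residual-++ X⊨ Y⊨

  Residual-singleton : ∀ {A r} → restrict A ≡ r → r ≢ top → Residual (A ∷ []) (disjunctsʳ r)
  Residual-singleton {A} refl r≢top =
    (λ { (here A⊨) → r≢top A⊨ }) , ≋-reflexive (++-identityʳ (residueOf A))

  restrictsTo-singleton : (A : Form V) → (A ∷ []) restrictsTo restrict A
  restrictsTo-singleton A with restrict A in e
  ... | top    = here e
  ... | bot    = Residual-singleton e λ ()
  ... | form a = Residual-singleton e λ ()

  restrictsTo-flat : (A : Form V) → flat A restrictsTo restrict A
  restrictsTo-flat (lit v b) = restrictsTo-singleton (lit v b)
  restrictsTo-flat (A ∧ᶠ B)  = restrictsTo-singleton (A ∧ᶠ B)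
  restrictsTo-flat (A ∨ᶠ B)  =
    restrictsTo-∨ʳ (restrict A) (restrict B) (restrictsTo-flat A) (restrictsTo-flat B)

  restrictsTo-flat-dual : (A : Form V) → flat (dual A) restrictsTo dualʳ (restrict A)
  restrictsTo-flat-dual A = subst (flat (dual A) restrictsTo_) (restrict-dual A) (restrictsTo-flat (dual A))

  restrictLine : Line → Line
  restrictLine Θ = residue ⟦ Θ ⟧

  restrictLine-IsΣ : ∀ {d} (Θ : Line) → All (IsΣ d) Θ → All (IsΣ d) (restrictLine Θ)
  restrictLine-IsΣ Θ Θ-depth = All.tabulate λ w∈ →
    let (A , A∈ , w∈A) = find (∈-concatMap⁻ residueOf w∈)
        (B , B∈ , A∈B) = find (∈-concatMap⁻ flat A∈)
    in residueOf-IsΣ (IsΣ-flat (All.lookup Θ-depth B∈) A∈B) w∈A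

  restrictLine-size : (Θ : Line) → lineSize (restrictLine Θ) ≤ lineSize Θ
  restrictLine-size Θ =
    ≤-trans (lineSize-concatMap residueOf residueOf-size ⟦ Θ ⟧) (lineSize-concatMap flat lineSize-flat Θ)

  Residual-line : ∀ Γ {P} → Residual ⟦ Γ ⟧ P → ⟦ restrictLine Γ ⟧ ≋ P
  Residual-line Γ (_ , Γ≋P) = ≋-trans (≋-reflexive (⟦residue⟧ ⟦ Γ ⟧)) Γ≋P

  Residual-self : ∀ Γ → ¬ Satisfied ⟦ Γ ⟧ → Residual ⟦ Γ ⟧ ⟦ restrictLine Γ ⟧
  Residual-self Γ ¬Γ = ¬Γ , ≋-reflexive (sym (⟦residue⟧ ⟦ Γ ⟧))

  Residual-premise : ∀ Γ C {X P} → ⟦ Γ ⟧ ≋ (⟦ C ⟧ ++ X) → ¬ Satisfied ⟦ C ⟧ → Residual X P →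
                     Residual ⟦ Γ ⟧ (⟦ restrictLine C ⟧ ++ P)
  Residual-premise Γ C Γ≋CX ¬C X⊨ = Residual-respˡ Γ≋CX (Residual-++ (Residual-self C ¬C) X⊨)

  restrictLine-⊆ : ∀ C Θ → ⟦ C ⟧ ⊆ ⟦ Θ ⟧ → ⟦ restrictLine C ⟧ ⊆ restrictLine Θ
  restrictLine-⊆ C Θ C⊆Θ = ⊆-trans (⊆-reflexive (⟦residue⟧ ⟦ C ⟧)) (concatMap⁺ residueOf C⊆Θ)

  restrictLines : List Line → List Line
  restrictLines []       = []
  restrictLines (Θ ∷ ls) with satisfied? ⟦ Θ ⟧
  ... | yes _ = restrictLines ls
  ... | no  _ = restrictLine Θ ∷ restrictLines ls

  ∈-restrictLines : ∀ {Γ ls} → Γ ∈ ls → ¬ Satisfied ⟦ Γ ⟧ → restrictLine Γ ∈ restrictLines ls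
  ∈-restrictLines {ls = Θ ∷ ls} Γ∈ ¬Γ with satisfied? ⟦ Θ ⟧ | Γ∈
  ... | yes Θ⊨ | here refl = ⊥-elim (¬Γ Θ⊨)
  ... | yes _  | there Γ∈′ = ∈-restrictLines Γ∈′ ¬Γ
  ... | no  _  | here refl = here refl
  ... | no  _  | there Γ∈′ = there (∈-restrictLines Γ∈′ ¬Γ)

  restrictLines-IsΣ : ∀ {d} (ls : List Line) → All (All (IsΣ d)) ls → All (All (IsΣ d)) (restrictLines ls)
  restrictLines-IsΣ []       []         = []
  restrictLines-IsΣ (Θ ∷ ls) (Θ-d ∷ ls-d) with satisfied? ⟦ Θ ⟧
  ... | yes _ = restrictLines-IsΣ ls ls-d
  ... | no  _ = restrictLine-IsΣ Θ Θ-d ∷ restrictLines-IsΣ ls ls-d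

  restrictLines-size : (ls : List Line) → proofSize (restrictLines ls) ≤ proofSize ls
  restrictLines-size []       = ≤-refl
  restrictLines-size (Θ ∷ ls) with satisfied? ⟦ Θ ⟧
  ... | yes _ = ≤-trans (restrictLines-size ls) (m≤n+m _ _)
  ... | no  _ = +-mono-≤ (restrictLine-size Θ) (restrictLines-size ls)

  module Derivations (Hyp : List (Form V) → Set) (Hyp′ : List (Form W) → Set)
    (restrict-hyp : ∀ {K} → Hyp K → ¬ Satisfied K → Σ (List (Form W)) λ K′ → Hyp′ K′ × residue K ≋ K′) where

    Rule′ : List Line → Line → Set
    Rule′ ls Θ = Rule Hyp′ (restrictLines ls) (restrictLine Θ)

    weaken-premise : ∀ {ls Γ} Θ {P} → Γ ∈ ls → Residual ⟦ Γ ⟧ P → P ⊆ restrictLine Θ → Rule′ ls Θ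
    weaken-premise {Γ = Γ} Θ Γ∈ Γ⊨ P⊆Θ =
      weak (∈-restrictLines Γ∈ (proj₁ Γ⊨))
           (⊆-trans (proj₁ (Residual-line Γ Γ⊨)) (⊆-trans P⊆Θ (⊆-reflexive (sym (⟦residue⟧ ⟦ Θ ⟧)))))

    weaken-side-premise : ∀ {ls Γ} C Θ {X P} → Γ ∈ ls → ⟦ Γ ⟧ ≋ (⟦ C ⟧ ++ X) → ⟦ C ⟧ ⊆ ⟦ Θ ⟧ →
                          ¬ Satisfied ⟦ Θ ⟧ → Residual X P → P ⊆ restrictLine Θ → Rule′ ls Θ
    weaken-side-premise {Γ = Γ} C Θ Γ∈ Γ≋ C⊆Θ ¬Θ X⊨ P⊆Θ =
      weaken-premise Θ Γ∈ (Residual-premise Γ C Γ≋ (¬Satisfied-⊆ C⊆Θ ¬Θ) X⊨)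
                     (++-lub (restrictLine-⊆ C Θ C⊆Θ) P⊆Θ)

    restrict-hyp-rule : ∀ {ls Θ K} → Hyp K → ⟦ Θ ⟧ ≋ K → ¬ Satisfied ⟦ Θ ⟧ → Rule′ ls Θ
    restrict-hyp-rule {Θ = Θ} h Θ≋K ¬Θ with restrict-hyp h (¬Satisfied-⊆ (proj₂ Θ≋K) ¬Θ)
    ... | K′ , h′ , K≋K′ = hyp h′ (Residual-line Θ (¬Θ , ≋-trans (residue-≋ Θ≋K) K≋K′))

    restrict-axm : ∀ {ls Θ} (A : Form V) → ⟦ Θ ⟧ ≋ (flat A ++ flat (dual A)) → ¬ Satisfied ⟦ Θ ⟧ → Rule′ ls Θ
    restrict-axm {ls} {Θ} A Θ≋ ¬Θ = go (restrict A) (restrictsTo-flat A) (restrictsTo-flat-dual A)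
      where
      go : (r : Restricted W) → flat A restrictsTo r → flat (dual A) restrictsTo dualʳ r → Rule′ ls Θ
      go top      A⊨  _   = ⊥-elim (¬Θ (Any-resp-⊆ (proj₂ Θ≋) (Anyₚ.++⁺ˡ A⊨)))
      go bot      _   dA⊨ = ⊥-elim (¬Θ (Any-resp-⊆ (proj₂ Θ≋) (Anyₚ.++⁺ʳ (flat A) dA⊨)))
      go (form a) A⊨  dA⊨ = axm a (Residual-line Θ (Residual-respˡ Θ≋ (Residual-++ A⊨ dA⊨)))

    restrict-cut : ∀ {ls Θ Γ Δ} (C D : Line) (A : Form V) → Γ ∈ ls → Δ ∈ ls →
                   ⟦ Γ ⟧ ≋ (⟦ C ⟧ ++ flat A) → ⟦ Δ ⟧ ≋ (⟦ D ⟧ ++ flat (dual A)) →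
                   ⟦ Θ ⟧ ≋ (⟦ C ⟧ ++ ⟦ D ⟧) → ¬ Satisfied ⟦ Θ ⟧ → Rule′ ls Θ
    restrict-cut {ls} {Θ} {Γ} {Δ} C D A Γ∈ Δ∈ Γ≋ Δ≋ Θ≋ ¬Θ =
      go (restrict A) (restrictsTo-flat A) (restrictsTo-flat-dual A)
      where
      C⊆Θ : ⟦ C ⟧ ⊆ ⟦ Θ ⟧
      C⊆Θ = ⊆-trans (xs⊆xs++ys ⟦ C ⟧ ⟦ D ⟧) (proj₂ Θ≋)
      D⊆Θ : ⟦ D ⟧ ⊆ ⟦ Θ ⟧
      D⊆Θ = ⊆-trans (xs⊆ys++xs ⟦ D ⟧ ⟦ C ⟧) (proj₂ Θ≋)
      ¬C : ¬ Satisfied ⟦ C ⟧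
      ¬C = ¬Satisfied-⊆ C⊆Θ ¬Θ
      ¬D : ¬ Satisfied ⟦ D ⟧
      ¬D = ¬Satisfied-⊆ D⊆Θ ¬Θ
      go : (r : Restricted W) → flat A restrictsTo r → flat (dual A) restrictsTo dualʳ r → Rule′ ls Θ
      go top      _   dA⊨ = weaken-side-premise D Θ Δ∈ Δ≋ D⊆Θ ¬Θ dA⊨ λ ()
      go bot      A⊨  _   = weaken-side-premise C Θ Γ∈ Γ≋ C⊆Θ ¬Θ A⊨ λ ()
      go (form a) A⊨  dA⊨ =
        cut (restrictLine C) (restrictLine D) a (∈-restrictLines Γ∈ (proj₁ Γ⊨)) (∈-restrictLines Δ∈ (proj₁ Δ⊨))
            (Residual-line Γ Γ⊨) (Residual-line Δ Δ⊨)
            (Residual-line Θ (Residual-respˡ Θ≋ (Residual-++ (Residual-self C ¬C) (Residual-self D ¬D))))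
        where
        Γ⊨ : Residual ⟦ Γ ⟧ (⟦ restrictLine C ⟧ ++ flat a)
        Γ⊨ = Residual-premise Γ C Γ≋ ¬C A⊨
        Δ⊨ : Residual ⟦ Δ ⟧ (⟦ restrictLine D ⟧ ++ flat (dual a))
        Δ⊨ = Residual-premise Δ D Δ≋ ¬D dA⊨

    restrict-∧I : ∀ {ls Θ Γ Δ} (C D : Line) (A B : Form V) → Γ ∈ ls → Δ ∈ ls →
                  ⟦ Γ ⟧ ≋ (⟦ C ⟧ ++ flat A) → ⟦ Δ ⟧ ≋ (⟦ D ⟧ ++ flat B) →
                  ⟦ Θ ⟧ ≋ (⟦ C ⟧ ++ ⟦ D ⟧ ++ flat (A ∧ᶠ B)) → ¬ Satisfied ⟦ Θ ⟧ → Rule′ ls Θ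
    restrict-∧I {ls} {Θ} {Γ} {Δ} C D A B Γ∈ Δ∈ Γ≋ Δ≋ Θ≋ ¬Θ =
      go (restrict A) (restrict B) (restrictsTo-flat A) (restrictsTo-flat B) (restrictsTo-singleton (A ∧ᶠ B))
      where
      Z : List (Form V)
      Z = flat (A ∧ᶠ B)
      C⊆Θ : ⟦ C ⟧ ⊆ ⟦ Θ ⟧
      C⊆Θ = ⊆-trans (xs⊆xs++ys ⟦ C ⟧ _) (proj₂ Θ≋)
      D⊆Θ : ⟦ D ⟧ ⊆ ⟦ Θ ⟧
      D⊆Θ = ⊆-trans (⊆-trans (xs⊆xs++ys ⟦ D ⟧ Z) (xs⊆ys++xs _ ⟦ C ⟧)) (proj₂ Θ≋)
      Z⊆Θ : Z ⊆ ⟦ Θ ⟧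
      Z⊆Θ = ⊆-trans (⊆-trans (xs⊆ys++xs Z ⟦ D ⟧) (xs⊆ys++xs _ ⟦ C ⟧)) (proj₂ Θ≋)
      residue-Z⊆Θ : ∀ {P} → Residual Z P → P ⊆ restrictLine Θ
      residue-Z⊆Θ (_ , _ , P⊆Z) = ⊆-trans P⊆Z (concatMap⁺ residueOf Z⊆Θ)
      go : (x y : Restricted W) → flat A restrictsTo x → flat B restrictsTo y → Z restrictsTo (x ∧ʳ y) → Rule′ ls Θ
      go bot      _        A⊨ _  _  = weaken-side-premise C Θ Γ∈ Γ≋ C⊆Θ ¬Θ A⊨ λ ()
      go top      bot      _  B⊨ _  = weaken-side-premise D Θ Δ∈ Δ≋ D⊆Θ ¬Θ B⊨ λ ()
      go (form a) bot      _  B⊨ _  = weaken-side-premise D Θ Δ∈ Δ≋ D⊆Θ ¬Θ B⊨ λ ()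
      go top      top      _  _  Z⊨ = ⊥-elim (¬Θ (Any-resp-⊆ Z⊆Θ Z⊨))
      go top      (form b) _  B⊨ Z⊨ = weaken-side-premise D Θ Δ∈ Δ≋ D⊆Θ ¬Θ B⊨ (residue-Z⊆Θ Z⊨)
      go (form a) top      A⊨ _  Z⊨ = weaken-side-premise C Θ Γ∈ Γ≋ C⊆Θ ¬Θ A⊨ (residue-Z⊆Θ Z⊨)
      go (form a) (form b) A⊨ B⊨ Z⊨ =
        ∧I (restrictLine C) (restrictLine D) a b (∈-restrictLines Γ∈ (proj₁ Γ⊨)) (∈-restrictLines Δ∈ (proj₁ Δ⊨))
           (Residual-line Γ Γ⊨) (Residual-line Δ Δ⊨)
           (Residual-line Θ (Residual-respˡ Θ≋
             (Residual-++ (Residual-self C ¬C) (Residual-++ (Residual-self D ¬D) Z⊨))))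
        where
        ¬C : ¬ Satisfied ⟦ C ⟧
        ¬C = ¬Satisfied-⊆ C⊆Θ ¬Θ
        ¬D : ¬ Satisfied ⟦ D ⟧
        ¬D = ¬Satisfied-⊆ D⊆Θ ¬Θ
        Γ⊨ : Residual ⟦ Γ ⟧ (⟦ restrictLine C ⟧ ++ flat a)
        Γ⊨ = Residual-premise Γ C Γ≋ ¬C A⊨
        Δ⊨ : Residual ⟦ Δ ⟧ (⟦ restrictLine D ⟧ ++ flat b)
        Δ⊨ = Residual-premise Δ D Δ≋ ¬D B⊨

    restrict-weak : ∀ {ls Θ Γ} → Γ ∈ ls → ⟦ Γ ⟧ ⊆ ⟦ Θ ⟧ → ¬ Satisfied ⟦ Θ ⟧ → Rule′ ls Θ
    restrict-weak {Θ = Θ} {Γ} Γ∈ Γ⊆Θ ¬Θ =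
      weaken-premise Θ Γ∈ (Residual-self Γ (¬Satisfied-⊆ Γ⊆Θ ¬Θ)) (restrictLine-⊆ Γ Θ Γ⊆Θ)

    restrict-rule : ∀ {ls Θ} → Rule Hyp ls Θ → ¬ Satisfied ⟦ Θ ⟧ → Rule′ ls Θ
    restrict-rule {ls} {Θ} (hyp h Θ≋K) = restrict-hyp-rule {ls} {Θ} h Θ≋K
    restrict-rule {ls} {Θ} (axm A Θ≋) = restrict-axm {ls} {Θ} A Θ≋
    restrict-rule {ls} {Θ} (cut C D A Γ∈ Δ∈ Γ≋ Δ≋ Θ≋) = restrict-cut {ls} {Θ} C D A Γ∈ Δ∈ Γ≋ Δ≋ Θ≋
    restrict-rule {ls} {Θ} (∧I C D A B Γ∈ Δ∈ Γ≋ Δ≋ Θ≋) = restrict-∧I {ls} {Θ} C D A B Γ∈ Δ∈ Γ≋ Δ≋ Θ≋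
    restrict-rule {ls} {Θ} (weak Γ∈ Γ⊆Θ) = restrict-weak {ls} {Θ} Γ∈ Γ⊆Θ

    restrict-derivation : ∀ {ls} → Derivation Hyp ls → Derivation Hyp′ (restrictLines ls)
    restrict-derivation []                = []
    restrict-derivation (step {Θ = Θ} D r) with satisfied? ⟦ Θ ⟧
    ... | yes _  = restrict-derivation D
    ... | no  ¬Θ = step (restrict-derivation D) (restrict-rule r ¬Θ)

    restrict-refutation : ∀ {d ls} → Refutation Hyp d ls → Refutation Hyp′ d (restrictLines ls)
    restrict-refutation {ls = ls} ((ls′ , refl) , D , ls-depth) =
      (restrictLines ls′ , refl) , restrict-derivation D , restrictLines-IsΣ ls ls-depth

    refutation-size-transfer : ∀ {d s} → (∀ ls → Refutation Hyp′ d ls → s ≤ proofSize ls) →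
                               ∀ ls → Refutation Hyp d ls → s ≤ proofSize ls
    refutation-size-transfer hard′ ls ref =
      ≤-trans (hard′ (restrictLines ls) (restrict-refutation ref)) (restrictLines-size ls)

-- ℤ_q as a summand of G

elems-complete : (qs : List ℕ) (g : Elem qs) → g ∈ elems qs
elems-complete []       tt      = here refl
elems-complete (q ∷ qs) (x , g) = ∈-concatMap⁺ _ (lose (∈-allFin x) (∈-map⁺ (x ,_) (elems-complete qs g)))

0ᴳ : ∀ {qs} → All (0 <_) qs → Elem qs
0ᴳ []             = tt
0ᴳ (s≤s z≤n ∷ ps) = zero , 0ᴳ ps

isZero : (qs : List ℕ) → Elem qs → Bool
isZero []       _           = true
isZero (q ∷ qs) (zero  , g) = isZero qs g
isZero (q ∷ qs) (suc _ , g) = false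

isZero-0ᴳ : ∀ {qs} (ps : All (0 <_) qs) → isZero qs (0ᴳ ps) ≡ true
isZero-0ᴳ []             = refl
isZero-0ᴳ (s≤s z≤n ∷ ps) = isZero-0ᴳ ps

isZero⇒≡0ᴳ : ∀ {qs} (ps : All (0 <_) qs) (g : Elem qs) → isZero qs g ≡ true → g ≡ 0ᴳ ps
isZero⇒≡0ᴳ []             tt          _ = refl
isZero⇒≡0ᴳ (s≤s z≤n ∷ ps) (zero , g)  e = cong (zero ,_) (isZero⇒≡0ᴳ ps g e)
isZero⇒≡0ᴳ (s≤s z≤n ∷ ps) (suc _ , g) ()

zero-solves : (k : ℕ) (z₁ z₂ z₃ : ℤ) → (+ k) ∣ ((z₁ ℤ.* + 0 ℤ.+ z₂ ℤ.* + 0 ℤ.+ z₃ ℤ.* + 0) ℤ.- + 0)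
zero-solves k z₁ z₂ z₃ rewrite *-zeroʳ z₁ | *-zeroʳ z₂ | *-zeroʳ z₃ = k ∣0

Holds-0ᴳ : ∀ {qs} (ps : All (0 <_) qs) (z₁ z₂ z₃ : ℤ) → Holds qs z₁ z₂ z₃ (0ᴳ ps) (0ᴳ ps) (0ᴳ ps) (0ᴳ ps)
Holds-0ᴳ []             _  _  _  = tt
Holds-0ᴳ (s≤s z≤n ∷ ps) z₁ z₂ z₃ = zero-solves _ z₁ z₂ z₃ , Holds-0ᴳ ps z₁ z₂ z₃

module _ {q : ℕ} where

  inject : ∀ {qs} → All (0 <_) qs → q ∈ qs → Fin q → Elem qs
  inject (_ ∷ ps)       (here refl) c = c , 0ᴳ ps
  inject (s≤s z≤n ∷ ps) (there p)   c = zero , inject ps p c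

  component : ∀ {qs} → q ∈ qs → Elem qs → Fin q
  component (here refl) (x , _) = x
  component (there p)   (_ , g) = component p g

  project : ∀ {qs} → q ∈ qs → Elem qs → Maybe (Fin q)
  project {_ ∷ qs} (here refl) (x , g)     = if isZero qs g then just x else nothing
  project          (there p)   (zero  , g) = project p g
  project          (there p)   (suc _ , g) = nothing

  project-inject : ∀ {qs} (ps : All (0 <_) qs) (p : q ∈ qs) (c : Fin q) → project p (inject ps p c) ≡ just c
  project-inject (_ ∷ ps)       (here refl) c rewrite isZero-0ᴳ ps = refl
  project-inject (s≤s z≤n ∷ ps) (there p)   c = project-inject ps p c

  project≡just⇒inject : ∀ {qs} (ps : All (0 <_) qs) (p : q ∈ qs) (g : Elem qs) {c : Fin q} →
                        project p g ≡ just c → g ≡ inject ps p c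
  project≡just⇒inject {_ ∷ qs} (_ ∷ ps) (here refl) (x , g) e with isZero qs g in g-zero
  project≡just⇒inject (_ ∷ ps) (here refl) (x , g) refl | true = cong (x ,_) (isZero⇒≡0ᴳ ps g g-zero)
  project≡just⇒inject (s≤s z≤n ∷ ps) (there p) (zero , g) e = cong (zero ,_) (project≡just⇒inject ps p g e)

  Holds-component : ∀ {qs} (ps : All (0 <_) qs) (p : q ∈ qs) {z₁ z₂ z₃ : ℤ} (g₁ g₂ g₃ : Elem qs) (c : Fin q) →
                    Holds qs z₁ z₂ z₃ g₁ g₂ g₃ (inject ps p c) →
                    Holds (q ∷ []) z₁ z₂ z₃ (component p g₁ , tt) (component p g₂ , tt) (component p g₃ , tt) (c , tt)
  Holds-component (_ ∷ ps)       (here refl) _         _         _         c (holds , _) = holds , tt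
  Holds-component (s≤s z≤n ∷ ps) (there p)   (_ , g₁) (_ , g₂) (_ , g₃) c (_ , holds) =
    Holds-component ps p g₁ g₂ g₃ c holds

  Holds-inject : ∀ {qs} (ps : All (0 <_) qs) (p : q ∈ qs) {z₁ z₂ z₃ : ℤ} (c₁ c₂ c₃ c : Fin q) →
                 Holds (q ∷ []) z₁ z₂ z₃ (c₁ , tt) (c₂ , tt) (c₃ , tt) (c , tt) →
                 Holds qs z₁ z₂ z₃ (inject ps p c₁) (inject ps p c₂) (inject ps p c₃) (inject ps p c)
  Holds-inject (_ ∷ ps)       (here refl) {z₁} {z₂} {z₃} _ _ _ _ (holds , _) = holds , Holds-0ᴳ ps z₁ z₂ z₃
  Holds-inject (s≤s z≤n ∷ ps) (there p)   {z₁} {z₂} {z₃} c₁ c₂ c₃ c holds =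
    zero-solves _ z₁ z₂ z₃ , Holds-inject ps p c₁ c₂ c₃ c holds

module Embedding {q : ℕ} {qs : List ℕ} (ps : All (0 <_) qs) (p : q ∈ qs) (n : ℕ) where

  embedEqn : Eqn (q ∷ []) n → Eqn qs n
  embedEqn (eqn z₁ z₂ z₃ (c , tt) a₁ a₂ a₃) = eqn z₁ z₂ z₃ (inject ps p c) a₁ a₂ a₃

  embed : Instance (q ∷ []) n → Instance qs n
  embed = map embedEqn

  embed-unsatisfiable : (A : Instance (q ∷ []) n) → Unsatisfiable A → Unsatisfiable (embed A)
  embed-unsatisfiable A unsat (h , h-hom) =
    unsat ((λ a → component p (h a) , tt) , All.map solves (map⁻ h-hom))
    where
    solves : ∀ {e} → let open Eqn e in
             Holds qs z₁ z₂ z₃ (h a₁) (h a₂) (h a₃) (inject ps p (proj₁ rhs)) →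
             Holds (q ∷ []) z₁ z₂ z₃ (component p (h a₁) , tt) (component p (h a₂) , tt) (component p (h a₃) , tt) rhs
    solves {e} = Holds-component ps p (h (Eqn.a₁ e)) (h (Eqn.a₂ e)) (h (Eqn.a₃ e)) (proj₁ (Eqn.rhs e))

  restrictVar : Var qs n → Maybe (Var (q ∷ []) n)
  restrictVar (a , g) = Maybe.map (λ c → a , (c , tt)) (project p g)

  open Restriction restrictVar

  residueOf-X⁺-inject : (a : Fin n) (c : Fin q) → residueOf (X⁺ a (inject ps p c)) ≡ X⁺ a (c , tt) ∷ []
  residueOf-X⁺-inject a c rewrite project-inject ps p c = refl

  restrict-X⁻-outside : (a : Fin n) (g : Elem qs) → project p g ≡ nothing → restrict (X⁻ a g) ≡ top
  restrict-X⁻-outside a g e rewrite e = refl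

  ∈-residueOf-X⁺ : (a : Fin n) (g : Elem qs) {w : Form (Var (q ∷ []) n)} → w ∈ residueOf (X⁺ a g) →
                   Σ (Fin q) λ c → w ≡ X⁺ a (c , tt)
  ∈-residueOf-X⁺ a g w∈ with project p g
  ∈-residueOf-X⁺ a g (here refl) | just c = c , refl

  X⁻-kept : ∀ {K} (a : Fin n) (g : Elem qs) → X⁻ a g ∈ K → ¬ Satisfied K →
            Σ (Fin q) λ c → g ≡ inject ps p c × residueOf (X⁻ a g) ≡ X⁻ a (c , tt) ∷ []
  X⁻-kept a g X⁻∈K ¬K with project p g in e
  ... | just c  = c , project≡just⇒inject ps p g e , refl
  ... | nothing = ⊥-elim (¬K (lose X⁻∈K (restrict-X⁻-outside a g e)))

  residue-atLeastOne : (a : Fin n) → residue (map (X⁺ a) (elems qs)) ≋ map (X⁺ a) (elems (q ∷ []))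
  residue-atLeastOne a = residue⊆ , ⊆residue
    where
    residue⊆ : residue (map (X⁺ a) (elems qs)) ⊆ map (X⁺ a) (elems (q ∷ []))
    residue⊆ w∈ with find (∈-concatMap⁻ residueOf {xs = map (X⁺ a) (elems qs)} w∈)
    ... | B , B∈ , w∈B with ∈-map⁻ (X⁺ a) B∈
    ... | g , _ , refl with ∈-residueOf-X⁺ a g w∈B
    ... | c , refl = ∈-map⁺ (X⁺ a) (elems-complete (q ∷ []) (c , tt))
    ⊆residue : map (X⁺ a) (elems (q ∷ [])) ⊆ residue (map (X⁺ a) (elems qs))
    ⊆residue w∈ with ∈-map⁻ (X⁺ a) w∈
    ... | (c , tt) , _ , refl = ∈-concatMap⁺ residueOf
      (lose (∈-map⁺ (X⁺ a) (elems-complete qs (inject ps p c)))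
            (subst (_ ∈_) (sym (residueOf-X⁺-inject a c)) (here refl)))

  restrict-CNF : (A : Instance (q ∷ []) n) → ∀ {K} → CNF (embed A) K → ¬ Satisfied K →
                 Σ (List (Form (Var (q ∷ []) n))) λ K′ → CNF A K′ × residue K ≋ K′
  restrict-CNF A (atLeastOne a) _ = _ , atLeastOne a , residue-atLeastOne a
  restrict-CNF A (atMostOne a g₀ g₁ g₀≢g₁) ¬K
    with X⁻-kept a g₀ (here refl) ¬K | X⁻-kept a g₁ (there (here refl)) ¬K
  ... | c₀ , refl , e₀ | c₁ , refl , e₁ =
    _ , atMostOne a (c₀ , tt) (c₁ , tt) (λ c₀≡c₁ → g₀≢g₁ (cong (inject ps p ∘ proj₁) c₀≡c₁)) ,
    ≋-reflexive (cong₂ _++_ e₀ (cong (_++ []) e₁))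
  restrict-CNF A (relation e e∈ g₁ g₂ g₃ fails) ¬K with ∈-map⁻ embedEqn e∈
  ... | e₀ , e₀∈A , refl
    with X⁻-kept _ g₁ (here refl) ¬K | X⁻-kept _ g₂ (there (here refl)) ¬K
       | X⁻-kept _ g₃ (there (there (here refl))) ¬K
  ... | c₁ , refl , e₁ | c₂ , refl , e₂ | c₃ , refl , e₃ =
    _ , relation e₀ e₀∈A (c₁ , tt) (c₂ , tt) (c₃ , tt) (λ holds → fails (Holds-inject ps p c₁ c₂ c₃ _ holds)) ,
    ≋-reflexive (cong₂ _++_ e₁ (cong₂ _++_ e₂ (cong (_++ []) e₃)))

  embed-hard : (A : Instance (q ∷ []) n) {d s : ℕ} → HardAtDepth A d s → HardAtDepth (embed A) d s
  embed-hard A = Derivations.refutation-size-transfer (CNF (embed A)) (CNF A) (restrict-CNF A)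

lemma6p9 : (qs : List ℕ) → All (0 <_) qs → (n d s : ℕ) → 1 ≤ n → 1 ≤ d → 1 ≤ s →
    Σ ℕ (λ q → q ∈ qs × Σ (Instance (q ∷ []) n) (λ A → Unsatisfiable A × HardAtDepth A d s)) →
    Σ (Instance qs n) (λ A′ → Unsatisfiable A′ × HardAtDepth A′ d s)
lemma6p9 qs ps n d s _ _ _ (q , q∈qs , A , unsat , hard) =
  embed A , embed-unsatisfiable A unsat , embed-hard A hard
  where open Embedding ps q∈qs n
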